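{- A hypersequent is atomic if and only if it is connected and has no two-ended edge.
   Context: **Hypersequents.** A hypersequent is a finite partial directed graph $(E,V,s,t)$, with partial source and target maps $s,t:E\rightharpoonup V$, which is acyclic as an undirected graph. Its underlying space $E+V$ carries the topology in which a set is open iff it contains all edges adjacent to each of its vertices. Connectedness refers to this topology. **Two-ended edges.** An edge $e$ is two-ended if both $s(e)$ and $t(e)$ are defined. **Sequents.** A sequent is a connected hypersequent with exactly one vertex. **Atomic hypersequents.** A hypersequent is atomic if it is either: - empty, - a single edge with no vertex, or - a sequent. -}

module Defs where

open import Data.Nat using (ℕ; zero; suc)
open import Data.Fin using (Fin; zero; suc; inject₁; fromℕ)
open import Data.Maybe using (Maybe; just; nothing)
open import Data.Bool using (Bool; true; false; not)
open import Data.Sum using (_⊎_; inj₁; inj₂)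
open import Data.Product using (Σ; _×_; ∃)
open import Function.Definitions using (Injective)
open import Relation.Binary.PropositionalEquality using (_≡_)
open import Relation.Nullary using (¬_)

-- A finite partial directed graph: edges Fin m, vertices Fin n,
-- partial source/target maps E ⇀ V represented as E → Maybe V.
record PreGraph : Set where
  field
    nE : ℕ
    nV : ℕ
    src : Fin nE → Maybe (Fin nV)
    tgt : Fin nE → Maybe (Fin nV)
open PreGraph public

Joins : (G : PreGraph) → Fin (nE G) → Fin (nV G) → Fin (nV G) → Set
Joins G e v w = (src G e ≡ just v × tgt G e ≡ just w) ⊎ (src G e ≡ just w × tgt G e ≡ just v)

-- A cycle of length (suc k) in the underlying undirected (multi)graph:
-- pairwise distinct edges es 0..k, vertices vs 0..k+1 with vs (k+1) = vs 0,
-- vs 0..k pairwise distinct, edge es i joining vs i and vs (i+1).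
-- (Covers self-loops (k = 0) and parallel edges (k = 1).)
record Cycle (G : PreGraph) : Set where
  field
    len : ℕ
    es : Fin (suc len) → Fin (nE G)
    vs : Fin (suc (suc len)) → Fin (nV G)
    es-inj : Injective _≡_ _≡_ es
    vs-inj : Injective _≡_ _≡_ (λ i → vs (inject₁ i))
    closed : vs (fromℕ (suc len)) ≡ vs zero
    joins : ∀ i → Joins G (es i) (vs (inject₁ i)) (vs (suc i))

Acyclic : PreGraph → Set
Acyclic G = ¬ Cycle G

record Hypersequent : Set where
  field
    graph : PreGraph
    acyclic : Acyclic graph
open Hypersequent public

Point : Hypersequent → Set
Point H = Fin (nE (graph H)) ⊎ Fin (nV (graph H))

Adjacent : (H : Hypersequent) → Fin (nE (graph H)) → Fin (nV (graph H)) → Set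
Adjacent H e v = (src (graph H) e ≡ just v) ⊎ (tgt (graph H) e ≡ just v)

Subset : Hypersequent → Set
Subset H = Point H → Bool

IsOpen : (H : Hypersequent) → Subset H → Set
IsOpen H U = ∀ v → U (inj₂ v) ≡ true → ∀ e → Adjacent H e v → U (inj₁ e) ≡ true

complement : (H : Hypersequent) → Subset H → Subset H
complement H U x = not (U x)

Connected : Hypersequent → Set
Connected H = ∀ (U : Subset H) → IsOpen H U → IsOpen H (complement H U) →
  (∀ x → U x ≡ false) ⊎ (∀ x → U x ≡ true)

TwoEnded : (H : Hypersequent) → Fin (nE (graph H)) → Set
TwoEnded H e = Σ (Fin (nV (graph H))) (λ v → src (graph H) e ≡ just v) ×
               Σ (Fin (nV (graph H))) (λ w → tgt (graph H) e ≡ just w)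

Sequent : Hypersequent → Set
Sequent H = Connected H × nV (graph H) ≡ 1

Atomic : Hypersequent → Set
Atomic H = (nE (graph H) ≡ 0 × nV (graph H) ≡ 0)
         ⊎ (nE (graph H) ≡ 1 × nV (graph H) ≡ 0)
         ⊎ Sequent H

-- An empty or single-edge hypersequent has at most one point, hence is connected; a
-- sequent is connected by definition, and a two-ended edge at its only vertex would be
-- a loop, i.e. a cycle.  Conversely, if no edge is two-ended then the star of a vertex
-- v (v together with the edges incident to it) is clopen: an edge at v has no other
-- end.  Connectedness then leaves room for at most one vertex; with no vertex at all
-- every subset is open, so a single edge is clopen and there is at most one edge.
module Submission where

open import Defs
open import Data.Product using (_×_)
open import Relation.Nullary using (¬_)
open import Function.Bundles using (_⇔_)

open import Data.Nat using (zero; suc)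
open import Data.Fin using (Fin; zero; suc; _≟_)
open import Data.Fin.Properties using (¬Fin0)
open import Data.Maybe using (Maybe; just)
open import Data.Maybe.Properties using (just-injective) renaming (≡-dec to ≡-decᴹ)
open import Data.Bool using (true; false; _∨_)
open import Data.Bool.Properties using (∨-zeroʳ)
open import Data.Sum using (_⊎_; inj₁; inj₂)
open import Data.Product using (_,_; uncurry)
open import Data.Empty using (⊥-elim)
open import Function using (_∘_)
open import Function.Bundles using (mk⇔)
open import Relation.Nullary using (does; yes; no; contradiction)
open import Relation.Nullary.Decidable using (dec-true; dec-false)
open import Relation.Binary.Definitions using (DecidableEquality)
open import Relation.Binary.PropositionalEquality
  using (_≡_; _≢_; refl; sym; trans; cong; cong₂; subst; module ≡-Reasoning)

_≟ᴹ_ : ∀ {n} → DecidableEquality (Maybe (Fin n))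
_≟ᴹ_ = ≡-decᴹ _≟_

Fin-empty : ∀ {n} → n ≡ 0 → ¬ Fin n
Fin-empty refl = ¬Fin0

Fin-unique : ∀ {n} → n ≡ 1 → (a b : Fin n) → a ≡ b
Fin-unique refl zero zero = refl

Fin-subsingleton⇒≤1 : ∀ {n} → ((a b : Fin n) → a ≡ b) → n ≡ 0 ⊎ n ≡ 1
Fin-subsingleton⇒≤1 {zero}        _      = inj₁ refl
Fin-subsingleton⇒≤1 {suc zero}    _      = inj₂ refl
Fin-subsingleton⇒≤1 {suc (suc n)} unique = contradiction (unique zero (suc zero)) λ ()

does-≟⇒≡ : ∀ {n} {a b : Fin n} → true ≡ does (a ≟ b) → a ≡ b
does-≟⇒≡ {a = a} {b} eq with a ≟ b
... | yes a≡b = a≡b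
does-≟⇒≡ () | no _

loop⇒cycle : (G : PreGraph) {e : Fin (nE G)} {v : Fin (nV G)} →
             src G e ≡ just v → tgt G e ≡ just v → Cycle G
loop⇒cycle G {e} {v} s t = record
  { len    = 0
  ; es     = λ _ → e
  ; vs     = λ _ → v
  ; es-inj = λ {i} {j} _ → Fin-unique refl i j
  ; vs-inj = λ {i} {j} _ → Fin-unique refl i j
  ; closed = refl
  ; joins  = λ _ → inj₁ (s , t)
  }

Clopen : (H : Hypersequent) → Subset H → Set
Clopen H U = IsOpen H U × IsOpen H (complement H U)

module _ (H : Hypersequent) where

  private
    G = graph H

  connected-of-empty : ¬ Point H → Connected H
  connected-of-empty ¬point U _ _ = inj₁ (⊥-elim ∘ ¬point)

  connected-of-singleton : (p : Point H) → (∀ x → x ≡ p) → Connected H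
  connected-of-singleton p only-p U _ _ with U p in Up
  ... | false = inj₁ λ x → trans (cong U (only-p x)) Up
  ... | true  = inj₂ λ x → trans (cong U (only-p x)) Up

  connected-clopen-constant : Connected H → (U : Subset H) → Clopen H U →
                              (x y : Point H) → U x ≡ U y
  connected-clopen-constant conn U (open-U , open-Uᶜ) x y with conn U open-U open-Uᶜ
  ... | inj₁ all-false = trans (all-false x) (sym (all-false y))
  ... | inj₂ all-true  = trans (all-true x) (sym (all-true y))

  single-vertex⇒¬TwoEnded : nV G ≡ 1 → ∀ e → ¬ TwoEnded H e
  single-vertex⇒¬TwoEnded v1 e ((v , s) , (w , t)) =
    acyclic H (loop⇒cycle G s (trans t (cong just (Fin-unique v1 w v))))

  vertexless⇒clopen : ¬ Fin (nV G) → (U : Subset H) → Clopen H U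
  vertexless⇒clopen ¬vertex _ = (λ v → ⊥-elim (¬vertex v)) , (λ v → ⊥-elim (¬vertex v))

  edge-indicator : Fin (nE G) → Subset H
  edge-indicator e (inj₁ f) = does (f ≟ e)
  edge-indicator e (inj₂ _) = false

  vertexless-edges-unique : Connected H → ¬ Fin (nV G) → (f e : Fin (nE G)) → f ≡ e
  vertexless-edges-unique conn ¬vertex f e = does-≟⇒≡ (begin
    true                      ≡⟨ sym (dec-true (e ≟ e) refl) ⟩
    edge-indicator e (inj₁ e) ≡⟨ connected-clopen-constant conn (edge-indicator e) clopen (inj₁ e) (inj₁ f) ⟩
    does (f ≟ e)              ∎)
    where
    open ≡-Reasoning
    clopen : Clopen H (edge-indicator e)
    clopen = vertexless⇒clopen ¬vertex (edge-indicator e)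

  star : Fin (nV G) → Subset H
  star v (inj₁ e) = does (src G e ≟ᴹ just v) ∨ does (tgt G e ≟ᴹ just v)
  star v (inj₂ w) = does (w ≟ v)

  star-adjacent : (v : Fin (nV G)) (e : Fin (nE G)) → Adjacent H e v → star v (inj₁ e) ≡ true
  star-adjacent v e (inj₁ s) rewrite s | dec-true (just v ≟ᴹ just v) refl = refl
  star-adjacent v e (inj₂ t) rewrite t | dec-true (just v ≟ᴹ just v) refl = ∨-zeroʳ _

  star-open : (v : Fin (nV G)) → IsOpen H (star v)
  star-open v w w∈star e adjacent with w ≟ v
  star-open v w () e adjacent | no _
  star-open v v w∈star e adjacent | yes refl = star-adjacent v e adjacent

  star-edge-outside : (v : Fin (nV G)) (e : Fin (nE G)) →
                      src G e ≢ just v → tgt G e ≢ just v → star v (inj₁ e) ≡ false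
  star-edge-outside v e ¬s ¬t =
    cong₂ _∨_ (dec-false (src G e ≟ᴹ just v) ¬s) (dec-false (tgt G e ≟ᴹ just v) ¬t)

  -- An edge at a vertex w ≢ v could reach v only through its other end.
  star-complement-open : (∀ e → ¬ TwoEnded H e) → (v : Fin (nV G)) →
                         IsOpen H (complement H (star v))
  star-complement-open one-ended v w w∉star e adjacent with w ≟ v
  star-complement-open one-ended v w () e adjacent | yes _
  star-complement-open one-ended v w w∉star e (inj₁ s) | no w≢v
    rewrite star-edge-outside v e (w≢v ∘ just-injective ∘ trans (sym s))
                                  (λ t → one-ended e ((w , s) , (v , t))) = refl
  star-complement-open one-ended v w w∉star e (inj₂ t) | no w≢v
    rewrite star-edge-outside v e (λ s → one-ended e ((v , s) , (w , t)))
                                  (w≢v ∘ just-injective ∘ trans (sym t)) = refl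

  vertices-unique : Connected H → (∀ e → ¬ TwoEnded H e) → (w v : Fin (nV G)) → w ≡ v
  vertices-unique conn one-ended w v = does-≟⇒≡ (begin
    true            ≡⟨ sym (dec-true (v ≟ v) refl) ⟩
    star v (inj₂ v) ≡⟨ connected-clopen-constant conn (star v) clopen (inj₂ v) (inj₂ w) ⟩
    does (w ≟ v)    ∎)
    where
    open ≡-Reasoning
    clopen : Clopen H (star v)
    clopen = star-open v , star-complement-open one-ended v

atomic⇒connected×oneEnded : (H : Hypersequent) → Atomic H → Connected H × (∀ e → ¬ TwoEnded H e)
atomic⇒connected×oneEnded H (inj₁ (e0 , v0)) =
  connected-of-empty H (λ { (inj₁ e) → Fin-empty e0 e ; (inj₂ v) → Fin-empty v0 v }) ,
  λ e _ → Fin-empty e0 e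
atomic⇒connected×oneEnded H (inj₂ (inj₁ (e1 , v0))) =
  connected-of-singleton H (inj₁ the-edge) only-the-edge ,
  λ { _ ((v , _) , _) → Fin-empty v0 v }
  where
  the-edge : Fin (nE (graph H))
  the-edge = subst Fin (sym e1) zero
  only-the-edge : ∀ x → x ≡ inj₁ the-edge
  only-the-edge (inj₁ e) = cong inj₁ (Fin-unique e1 e the-edge)
  only-the-edge (inj₂ v) = ⊥-elim (Fin-empty v0 v)
atomic⇒connected×oneEnded H (inj₂ (inj₂ (conn , v1))) = conn , single-vertex⇒¬TwoEnded H v1

connected×oneEnded⇒atomic : (H : Hypersequent) → Connected H → (∀ e → ¬ TwoEnded H e) → Atomic H
connected×oneEnded⇒atomic H conn one-ended with Fin-subsingleton⇒≤1 (vertices-unique H conn one-ended)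
... | inj₂ v1 = inj₂ (inj₂ (conn , v1))
... | inj₁ v0 with Fin-subsingleton⇒≤1 (vertexless-edges-unique H conn (Fin-empty v0))
...   | inj₁ e0 = inj₁ (e0 , v0)
...   | inj₂ e1 = inj₂ (inj₁ (e1 , v0))

mainTheorem4 : (H : Hypersequent) →
    Atomic H ⇔ (Connected H × (∀ e → ¬ TwoEnded H e))
mainTheorem4 H = mk⇔ (atomic⇒connected×oneEnded H) (uncurry (connected×oneEnded⇒atomic H))
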